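{- Let $(J,p,c,M)$ be an instance of the resource leveling problem with resource level $2$ and makespan deadline $M$ (no precedence constraints), where $c_i\in\{1,2\}$ for all $i$ and $p_{J_2}<M$, and let $x\in\mathbb{N}^J$ be a feasible schedule in which no two jobs of $J_2$ overlap. Then there exists a subset $J'\subseteq J_1$ such that $$F(x)\le 2p_{J_2}+\min\Big(\sum_{i\in J'}p_i,\ M-p_{J_2}\Big)+\min\Big(\sum_{i\in J_1\setminus J'}p_i,\ M-p_{J_2}\Big).$$
   Context: Jobs $i\in J$ have processing times $p_i\in\mathbb{N}$ and resource consumptions $c_i$; $M\in\mathbb{N}$. $J_1=\{i\in J: c_i=1\}$, $J_2=\{i\in J:c_i=2\}$, $p_{J_2}=\sum_{i\in J_2}p_i$. A schedule $x\in\mathbb{N}^J$ is feasible if $C_{max}(x)=\max_i(x_i+p_i)\le M$; jobs $i,j$ overlap if $[x_i,x_i+p_i)\cap[x_j,x_j+p_j)\ne\emptyset$. With $r_\tau(x)=\sum_{i:x_i\le\tau<x_i+p_i}c_i$, $F(x)=\sum_{\tau=0}^{C_{max}(x)-1}\min(2,r_\tau(x))$. -}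

module Defs where

open import Data.Nat using (ℕ; zero; suc; _+_; _≤_; _<_; _⊔_; _⊓_; _≤ᵇ_; _<ᵇ_; _≡ᵇ_; _∸_)
open import Data.Bool using (Bool; true; false; if_then_else_; _∧_; not)
open import Data.Fin using (Fin; zero; suc)
open import Data.Product using (_×_; ∃-syntax)
open import Relation.Binary.PropositionalEquality using (_≡_)

Σᶠ : (n : ℕ) → (Fin n → ℕ) → ℕ
Σᶠ zero    f = 0
Σᶠ (suc n) f = f zero + Σᶠ n (λ i → f (suc i))

Σ< : ℕ → (ℕ → ℕ) → ℕ
Σ< zero    g = 0
Σ< (suc T) g = Σ< T g + g T

-- Jobs are Fin n; p = processing times, c = resource consumptions, x = start times.

Cmax : (n : ℕ) → (p x : Fin n → ℕ) → ℕ
Cmax zero    p x = 0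
Cmax (suc n) p x = (x zero + p zero) ⊔ Cmax n (λ i → p (suc i)) (λ i → x (suc i))

running : ℕ → ℕ → ℕ → Bool
running xi pi τ = (xi ≤ᵇ τ) ∧ (τ <ᵇ xi + pi)

r : (n : ℕ) → (p c x : Fin n → ℕ) → ℕ → ℕ
r n p c x τ = Σᶠ n (λ i → if running (x i) (p i) τ then c i else 0)

F : (n : ℕ) → (p c x : Fin n → ℕ) → ℕ
F n p c x = Σ< (Cmax n p x) (λ τ → 2 ⊓ r n p c x τ)

Feasible : (n : ℕ) → (p x : Fin n → ℕ) → ℕ → Set
Feasible n p x M = Cmax n p x ≤ M

Overlap : ℕ → ℕ → ℕ → ℕ → Set
Overlap xi pi xj pj = ∃[ τ ] ((xi ≤ τ × τ < xi + pi) × (xj ≤ τ × τ < xj + pj))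

pJ2 : (n : ℕ) → (p c : Fin n → ℕ) → ℕ
pJ2 n p c = Σᶠ n (λ i → if c i ≡ᵇ 2 then p i else 0)

-- J' ⊆ J_1 is encoded by an indicator S : Fin n → Bool, J' = { i ∈ J_1 | S i = true }.
-- Σ_{i ∈ J'} p_i
pJ' : (n : ℕ) → (p c : Fin n → ℕ) → (Fin n → Bool) → ℕ
pJ' n p c S = Σᶠ n (λ i → if (c i ≡ᵇ 1) ∧ S i then p i else 0)

pJ1∖J' : (n : ℕ) → (p c : Fin n → ℕ) → (Fin n → Bool) → ℕ
pJ1∖J' n p c S = Σᶠ n (λ i → if (c i ≡ᵇ 1) ∧ not (S i) then p i else 0)

{-# OPTIONS --safe #-}
module Submission where

-- Only times with no J₂ job running need care, since a running J₂ job already pays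
-- 2 ≥ min(2, r_τ). Colour the J₁ jobs (viewed as intervals) greedily by start time,
-- always giving a new interval the colour whose intervals so far end earlier; then at every
-- time at which two J₁ jobs run, both colours run. At a time with no J₂ job this gives
-- min(2, r_τ) ≤ min(1, r′_τ) + min(1, r″_τ) for the loads r′, r″ of the two colour classes
-- J′, J₁ ∖ J′. Summing over τ, the J₂-free times number at most M − p_{J₂} because the J₂
-- jobs are disjoint, which bounds each of the two sums by the corresponding minimum.

open import Algebra.Properties.CommutativeSemigroup using (interchange)
open import Data.Bool using (Bool; true; false; T; not; _∧_; if_then_else_)
open import Data.Bool.Properties using (T-∧; ¬-not; not-involutive) renaming (_≟_ to _≟ᵇ_)
open import Data.Empty using (⊥-elim)
open import Data.Fin using (Fin; zero; suc; toℕ)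
open import Data.Fin.Properties using (toℕ<n; toℕ-injective; suc-injective)
open import Data.Nat
  using (ℕ; zero; suc; _+_; _*_; _∸_; _≤_; _<_; _⊓_; _⊔_; _≤ᵇ_; _<ᵇ_; _≡ᵇ_; z≤n; s≤s)
open import Data.Nat.Properties hiding (suc-injective)
open import Data.Product using (∃-syntax; _×_; _,_; proj₁; proj₂)
open import Data.Sum using (_⊎_; inj₁; inj₂)
open import Data.Unit using (tt)
open import Function using (_∘_)
open import Function.Bundles using (Equivalence)
open import Relation.Binary.Definitions using (tri<; tri≈; tri>)
open import Relation.Binary.PropositionalEquality
open import Relation.Nullary using (¬_; yes; no)

open import Defs

⟦_⟧ : Bool → ℕ
⟦ b ⟧ = if b then 1 else 0

matches : Bool → Bool → Bool
matches true  b = b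
matches false b = not b

≡⇒matches : ∀ {β b} → b ≡ β → T (matches β b)
≡⇒matches {true}  refl = tt
≡⇒matches {false} refl = tt

matches⇒≡ : ∀ β b → T (matches β b) → b ≡ β
matches⇒≡ true  true  _ = refl
matches⇒≡ false false _ = refl

if-⟦⟧ : ∀ r b → (if r then ⟦ b ⟧ else 0) ≡ ⟦ r ∧ b ⟧
if-⟦⟧ true  b = refl
if-⟦⟧ false b = refl

*-⟦⟧ : ∀ m b → m * ⟦ b ⟧ ≡ (if b then m else 0)
*-⟦⟧ m true  = *-identityʳ m
*-⟦⟧ m false = *-zeroʳ m

if-T : ∀ {A : Set} {b} {u v : A} → T b → (if b then u else v) ≡ u
if-T {b = true} _ = refl

<-if⇒ : ∀ b {m τ} → τ < (if b then m else 0) → T b × τ < m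
<-if⇒ true lt = tt , lt

argmin : (Bool → ℕ) → Bool
argmin f = f true ≤ᵇ f false

argmin-minimal : ∀ f → f (argmin f) ≤ f (not (argmin f))
argmin-minimal f with argmin f in eq
... | true  = ≤ᵇ⇒≤ (f true) (f false) (subst T (sym eq) tt)
... | false = <⇒≤ (≰⇒> λ le → subst T eq (≤⇒≤ᵇ {f true} {f false} le))

Runs : ℕ → ℕ → ℕ → Set
Runs xi pi τ = xi ≤ τ × τ < xi + pi

running⇒Runs : ∀ xi pi τ → T (running xi pi τ) → Runs xi pi τ
running⇒Runs xi pi τ h with Equivalence.to T-∧ h
... | start , stop = ≤ᵇ⇒≤ xi τ start , <ᵇ⇒< τ (xi + pi) stop

Runs⇒running : ∀ {xi pi τ} → Runs xi pi τ → T (running xi pi τ)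
Runs⇒running (start , stop) = Equivalence.from T-∧ (≤⇒≤ᵇ start , <⇒<ᵇ stop)

running-∧⇒ : ∀ xi pi τ b → T (running xi pi τ ∧ b) → Runs xi pi τ × T b
running-∧⇒ xi pi τ b h with Equivalence.to T-∧ h
... | r , t = running⇒Runs xi pi τ r , t

Runs-if⇒ : ∀ b {xi pi τ} → Runs xi (if b then pi else 0) τ → T b × Runs xi pi τ
Runs-if⇒ true  r = tt , r
Runs-if⇒ false {xi} {τ = τ} (start , stop) =
  ⊥-elim (<⇒≱ (subst (τ <_) (+-identityʳ xi) stop) start)

running-outside : ∀ {xi pi τ} → ¬ Runs xi pi τ → running xi pi τ ≡ false
running-outside {xi} {pi} {τ} ¬r with running xi pi τ in eq
... | true  = ⊥-elim (¬r (running⇒Runs xi pi τ (subst T (sym eq) tt)))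
... | false = refl

Σ<-cong : ∀ T {f g : ℕ → ℕ} → (∀ {τ} → τ < T → f τ ≡ g τ) → Σ< T f ≡ Σ< T g
Σ<-cong zero    eq = refl
Σ<-cong (suc T) eq = cong₂ _+_ (Σ<-cong T (eq ∘ m<n⇒m<1+n)) (eq (n<1+n T))

Σ<-const : ∀ T w → Σ< T (λ _ → w) ≡ T * w
Σ<-const zero    w = refl
Σ<-const (suc T) w = trans (cong (_+ w) (Σ<-const T w)) (+-comm (T * w) w)

Σ<-mono : ∀ T {f g : ℕ → ℕ} → (∀ τ → f τ ≤ g τ) → Σ< T f ≤ Σ< T g
Σ<-mono zero    le = z≤n
Σ<-mono (suc T) le = +-mono-≤ (Σ<-mono T le) (le T)

Σ<-+ : ∀ T (f g : ℕ → ℕ) → Σ< T (λ τ → f τ + g τ) ≡ Σ< T f + Σ< T g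
Σ<-+ zero    f g = refl
Σ<-+ (suc T) f g =
  trans (cong (_+ (f T + g T)) (Σ<-+ T f g)) (interchange +-commutativeSemigroup (Σ< T f) _ _ _)

Σ<-* : ∀ T k (f : ℕ → ℕ) → Σ< T (λ τ → k * f τ) ≡ k * Σ< T f
Σ<-* zero    k f = sym (*-zeroʳ k)
Σ<-* (suc T) k f = trans (cong (_+ k * f T) (Σ<-* T k f)) (sym (*-distribˡ-+ k _ _))

Σ<-⊓ : ∀ T (f g : ℕ → ℕ) → Σ< T (λ τ → f τ ⊓ g τ) ≤ Σ< T f ⊓ Σ< T g
Σ<-⊓ T f g = ⊓-glb (Σ<-mono T λ τ → m⊓n≤m (f τ) (g τ)) (Σ<-mono T λ τ → m⊓n≤n (f τ) (g τ))

Σ<-split : ∀ a b (f : ℕ → ℕ) → Σ< (a + b) f ≡ Σ< a f + Σ< b (λ t → f (a + t))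
Σ<-split a zero    f = trans (cong (λ k → Σ< k f) (+-identityʳ a)) (sym (+-identityʳ _))
Σ<-split a (suc b) f = begin
  Σ< (a + suc b) f                             ≡⟨ cong (λ k → Σ< k f) (+-suc a b) ⟩
  Σ< (a + b) f + f (a + b)                     ≡⟨ cong (_+ f (a + b)) (Σ<-split a b f) ⟩
  Σ< a f + Σ< b (λ t → f (a + t)) + f (a + b)  ≡⟨ +-assoc (Σ< a f) _ _ ⟩
  Σ< a f + (Σ< b (λ t → f (a + t)) + f (a + b)) ∎
  where open ≡-Reasoning

Σ<-complement : ∀ T (f : ℕ → ℕ) → (∀ τ → f τ ≤ 1) → Σ< T (λ τ → 1 ∸ f τ) + Σ< T f ≡ T
Σ<-complement T f f≤1 = begin
  Σ< T (λ τ → 1 ∸ f τ) + Σ< T f  ≡⟨ Σ<-+ T (λ τ → 1 ∸ f τ) f ⟨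
  Σ< T (λ τ → 1 ∸ f τ + f τ)     ≡⟨ Σ<-cong T (λ {τ} _ → m∸n+n≡m (f≤1 τ)) ⟩
  Σ< T (λ _ → 1)                 ≡⟨ Σ<-const T 1 ⟩
  T * 1                          ≡⟨ *-identityʳ T ⟩
  T                              ∎
  where open ≡-Reasoning

Σ<-running : ∀ xi pi {T} w → xi + pi ≤ T
           → Σ< T (λ τ → if running xi pi τ then w else 0) ≡ pi * w
Σ<-running xi pi {T} w xi+pi≤T = begin
  Σ< T f                                         ≡⟨ cong (λ t → Σ< t f) (m+[n∸m]≡n xi+pi≤T) ⟨
  Σ< (xi + pi + k) f                             ≡⟨ Σ<-split (xi + pi) k f ⟩
  Σ< (xi + pi) f + Σ< k (λ t → f (xi + pi + t))
    ≡⟨ cong (_+ Σ< k (λ t → f (xi + pi + t))) (Σ<-split xi pi f) ⟩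
  Σ< xi f + Σ< pi (λ t → f (xi + t)) + Σ< k (λ t → f (xi + pi + t))
    ≡⟨ cong₂ (λ u v → u + Σ< pi (λ t → f (xi + t)) + v) before after ⟩
  Σ< pi (λ t → f (xi + t)) + 0                   ≡⟨ +-identityʳ _ ⟩
  Σ< pi (λ t → f (xi + t))                       ≡⟨ Σ<-cong pi during ⟩
  Σ< pi (λ _ → w)                                ≡⟨ Σ<-const pi w ⟩
  pi * w                                         ∎
  where
    open ≡-Reasoning
    f : ℕ → ℕ
    f τ = if running xi pi τ then w else 0
    k : ℕ
    k = T ∸ (xi + pi)
    idle : ∀ {τ} → ¬ Runs xi pi τ → f τ ≡ 0
    idle ¬r = cong (λ b → if b then w else 0) (running-outside ¬r)
    before : Σ< xi f ≡ 0
    before = trans (Σ<-cong xi λ τ<xi → idle λ r → <⇒≱ τ<xi (proj₁ r))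
                   (trans (Σ<-const xi 0) (*-zeroʳ xi))
    after : Σ< k (λ t → f (xi + pi + t)) ≡ 0
    after = trans (Σ<-cong k λ _ → idle λ r → <⇒≱ (proj₂ r) (m≤m+n _ _))
                  (trans (Σ<-const k 0) (*-zeroʳ k))
    during : ∀ {t} → t < pi → f (xi + t) ≡ w
    during t<pi = if-T (Runs⇒running {xi} {pi} (m≤m+n xi _ , +-monoʳ-< xi t<pi))

Σᶠ-cong : ∀ n {f g : Fin n → ℕ} → (∀ i → f i ≡ g i) → Σᶠ n f ≡ Σᶠ n g
Σᶠ-cong zero    eq = refl
Σᶠ-cong (suc n) eq = cong₂ _+_ (eq zero) (Σᶠ-cong n (eq ∘ suc))

Σᶠ-mono : ∀ n {f g : Fin n → ℕ} → (∀ i → f i ≤ g i) → Σᶠ n f ≤ Σᶠ n g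
Σᶠ-mono zero    le = z≤n
Σᶠ-mono (suc n) le = +-mono-≤ (le zero) (Σᶠ-mono n (le ∘ suc))

Σᶠ-+ : ∀ n (f g : Fin n → ℕ) → Σᶠ n (λ i → f i + g i) ≡ Σᶠ n f + Σᶠ n g
Σᶠ-+ zero    f g = refl
Σᶠ-+ (suc n) f g = trans (cong (f zero + g zero +_) (Σᶠ-+ n (f ∘ suc) (g ∘ suc)))
                         (interchange +-commutativeSemigroup (f zero) (g zero) _ _)

Σᶠ-* : ∀ n k (f : Fin n → ℕ) → Σᶠ n (λ i → k * f i) ≡ k * Σᶠ n f
Σᶠ-* zero    k f = sym (*-zeroʳ k)
Σᶠ-* (suc n) k f = trans (cong (k * f zero +_) (Σᶠ-* n k (f ∘ suc))) (sym (*-distribˡ-+ k _ _))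

Σ<-Σᶠ-comm : ∀ T n (g : Fin n → ℕ → ℕ)
           → Σ< T (λ τ → Σᶠ n (λ i → g i τ)) ≡ Σᶠ n (λ i → Σ< T (g i))
Σ<-Σᶠ-comm T zero    g = trans (Σ<-const T 0) (*-zeroʳ T)
Σ<-Σᶠ-comm T (suc n) g = trans (Σ<-+ T (g zero) (λ τ → Σᶠ n (λ i → g (suc i) τ)))
                               (cong (Σ< T (g zero) +_) (Σ<-Σᶠ-comm T n (g ∘ suc)))

2*+-linear : ∀ {A : Set} (Σ : (A → ℕ) → ℕ)
           → (∀ f g → Σ (λ a → f a + g a) ≡ Σ f + Σ g)
           → (∀ f → Σ (λ a → 2 * f a) ≡ 2 * Σ f)
           → ∀ f g h → Σ (λ a → 2 * f a + g a + h a) ≡ 2 * Σ f + Σ g + Σ h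
2*+-linear Σ Σ-+ Σ-2* f g h = begin
  Σ (λ a → 2 * f a + g a + h a)  ≡⟨ Σ-+ _ h ⟩
  Σ (λ a → 2 * f a + g a) + Σ h  ≡⟨ cong (_+ Σ h) (Σ-+ _ g) ⟩
  Σ (λ a → 2 * f a) + Σ g + Σ h  ≡⟨ cong (λ s → s + Σ g + Σ h) (Σ-2* f) ⟩
  2 * Σ f + Σ g + Σ h            ∎
  where open ≡-Reasoning

count : ∀ n → (Fin n → Bool) → ℕ
count n f = Σᶠ n (⟦_⟧ ∘ f)

count-pos : ∀ n (f : Fin n → Bool) i → T (f i) → 1 ≤ count n f
count-pos (suc n) f zero    t with f zero
... | true = s≤s z≤n
count-pos (suc n) f (suc i) t = ≤-trans (count-pos n (f ∘ suc) i t) (m≤n+m _ _)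

count-pos⇒ : ∀ n (f : Fin n → Bool) → 1 ≤ count n f → ∃[ i ] T (f i)
count-pos⇒ (suc n) f h with f zero in eq
... | true  = zero , subst T (sym eq) tt
... | false with count-pos⇒ n (f ∘ suc) h
...   | i , t = suc i , t

count-≥2⇒ : ∀ n (f : Fin n → Bool) → 2 ≤ count n f → ∃[ a ] ∃[ b ] (a ≢ b × T (f a) × T (f b))
count-≥2⇒ (suc n) f h with f zero in eq
... | true with count-pos⇒ n (f ∘ suc) (≤-pred h)
...   | i , t = zero , suc i , (λ ()) , subst T (sym eq) tt , t
count-≥2⇒ (suc n) f h | false with count-≥2⇒ n (f ∘ suc) h
...   | a , b , a≢b , ta , tb = suc a , suc b , a≢b ∘ suc-injective , ta , tb

maxᶠ : ∀ n → (Fin n → ℕ) → ℕ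
maxᶠ zero    f = 0
maxᶠ (suc n) f = f zero ⊔ maxᶠ n (f ∘ suc)

≤-maxᶠ : ∀ n (f : Fin n → ℕ) i → f i ≤ maxᶠ n f
≤-maxᶠ (suc n) f zero    = m≤m⊔n _ _
≤-maxᶠ (suc n) f (suc i) = ≤-trans (≤-maxᶠ n (f ∘ suc) i) (m≤n⊔m _ _)

<-maxᶠ⇒ : ∀ n (f : Fin n → ℕ) {τ} → τ < maxᶠ n f → ∃[ i ] τ < f i
<-maxᶠ⇒ (suc n) f {τ} lt with ⊔-sel (f zero) (maxᶠ n (f ∘ suc))
... | inj₁ eq = zero , subst (τ <_) eq lt
... | inj₂ eq with <-maxᶠ⇒ n (f ∘ suc) (subst (τ <_) eq lt)
...   | i , lt′ = suc i , lt′

≤-Cmax : ∀ n (p x : Fin n → ℕ) i → x i + p i ≤ Cmax n p x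
≤-Cmax (suc n) p x zero    = m≤m⊔n _ _
≤-Cmax (suc n) p x (suc i) = ≤-trans (≤-Cmax n (p ∘ suc) (x ∘ suc) i) (m≤n⊔m _ _)

module IntervalColouring {n : ℕ} (x q : Fin n → ℕ) where

  Active : Fin n → ℕ → Set
  Active i = Runs (x i) (q i)

  Balanced : (Fin n → Bool) → Set
  Balanced col = ∀ τ β {a b} → a ≢ b → Active a τ → Active b τ → ∃[ d ] (Active d τ × col d ≡ β)

  end : Fin n → ℕ
  end i = x i + q i

  -- Intervals are coloured one at a time in the order of key: by start time, ties broken by index.
  key : Fin n → ℕ
  key i = x i * n + toℕ i

  key-mono : ∀ {a b} → x a < x b → key a < key b
  key-mono {a} {b} lt = begin-strict
    x a * n + toℕ a  <⟨ +-monoʳ-< (x a * n) (toℕ<n a) ⟩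
    x a * n + n      ≡⟨ +-comm (x a * n) n ⟩
    suc (x a) * n    ≤⟨ *-monoˡ-≤ n lt ⟩
    x b * n          ≤⟨ m≤m+n _ _ ⟩
    x b * n + toℕ b  ∎
    where open ≤-Reasoning

  key<⇒start≤ : ∀ {a b} → key a < key b → x a ≤ x b
  key<⇒start≤ lt = ≮⇒≥ λ gt → <-asym lt (key-mono gt)

  key-injective : ∀ {a b} → key a ≡ key b → a ≡ b
  key-injective {a} {b} eq with <-cmp (x a) (x b)
  ... | tri< lt _ _ = ⊥-elim (<-irrefl eq (key-mono lt))
  ... | tri> _ _ gt = ⊥-elim (<-irrefl (sym eq) (key-mono gt))
  ... | tri≈ _ same _ =
    toℕ-injective (+-cancelˡ-≡ (x a * n) _ _ (trans eq (cong (λ s → s * n + toℕ b) (sym same))))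

  frontier : (Fin n → Bool) → ℕ → Bool → ℕ
  frontier col K β = maxᶠ n (λ i → if (key i <ᵇ K) ∧ matches β (col i) then end i else 0)

  end≤frontier : ∀ col {K β i} → key i < K → col i ≡ β → end i ≤ frontier col K β
  end≤frontier col {K} {β} {i} lt eq = subst (_≤ frontier col K β) (if-T member) (≤-maxᶠ n _ i)
    where
      member : T ((key i <ᵇ K) ∧ matches β (col i))
      member = Equivalence.from T-∧ (<⇒<ᵇ lt , ≡⇒matches eq)

  <-frontier⇒ : ∀ col {K β τ} → τ < frontier col K β → ∃[ d ] (key d < K × col d ≡ β × τ < end d)
  <-frontier⇒ col {K} {β} lt with <-maxᶠ⇒ n _ lt
  ... | d , lt′ with <-if⇒ ((key d <ᵇ K) ∧ matches β (col d)) lt′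
  ...   | member , τ<end with Equivalence.to T-∧ member
  ...     | early , coloured = d , <ᵇ⇒< _ _ early , matches⇒≡ β (col d) coloured , τ<end

  greedy : ℕ → Fin n → Bool
  greedy zero    _ = true
  greedy (suc K) i = if key i ≡ᵇ K then argmin (frontier (greedy K) K) else greedy K i

  greedy-old : ∀ {K i} → key i < K → greedy (suc K) i ≡ greedy K i
  greedy-old {K} {i} lt with key i ≡ᵇ K in eq
  ... | true  = ⊥-elim (<-irrefl (≡ᵇ⇒≡ _ _ (subst T (sym eq) tt)) lt)
  ... | false = refl

  greedy-new : ∀ {K i} → key i ≡ K → greedy (suc K) i ≡ argmin (frontier (greedy K) K)
  greedy-new {K} {i} eq = if-T (≡⇒≡ᵇ (key i) K eq)

  BalancedBelow : ℕ → (Fin n → Bool) → Set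
  BalancedBelow K col = ∀ τ β {a b} → a ≢ b → key a < K → key b < K → Active a τ → Active b τ
                      → ∃[ d ] (key d < K × Active d τ × col d ≡ β)

  -- The newcomer a gets the colour whose earlier intervals end first; as b of that colour still
  -- runs at τ, so does some earlier interval d of the other colour, which started no later than a.
  rival-active : ∀ {K τ a b} → key a ≡ K → key b < K → Active a τ → Active b τ
               → greedy K b ≡ argmin (frontier (greedy K) K)
               → ∃[ d ] (key d < K × Active d τ × greedy K d ≡ not (greedy K b))
  rival-active {K} {τ} {a} {b} refl kb ra rb same with <-frontier⇒ (greedy K) τ<frontier
    where
      τ<frontier : τ < frontier (greedy K) K (not (greedy K b))
      τ<frontier = begin-strict
        τ                                        <⟨ proj₂ rb ⟩
        end b                                    ≤⟨ end≤frontier (greedy K) kb same ⟩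
        frontier (greedy K) K γ                  ≤⟨ argmin-minimal (frontier (greedy K) K) ⟩
        frontier (greedy K) K (not γ)            ≡⟨ cong (frontier (greedy K) K ∘ not) same ⟨
        frontier (greedy K) K (not (greedy K b)) ∎
        where
          open ≤-Reasoning
          γ : Bool
          γ = argmin (frontier (greedy K) K)
  ... | d , kd , coloured , τ<end =
    d , kd , (≤-trans (key<⇒start≤ kd) (proj₁ ra) , τ<end) , coloured

  newcomer-balanced : ∀ K τ β {a b} → key a ≡ K → key b < K → Active a τ → Active b τ
                    → ∃[ d ] (key d < suc K × Active d τ × greedy (suc K) d ≡ β)
  newcomer-balanced K τ β {a} {b} ka kb ra rb
    with greedy K b ≟ᵇ β | argmin (frontier (greedy K) K) ≟ᵇ β
  ... | yes b-β | _ = b , m<n⇒m<1+n kb , rb , trans (greedy-old kb) b-β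
  ... | no _ | yes a-β = a , s≤s (≤-reflexive ka) , ra , trans (greedy-new ka) a-β
  ... | no b-¬β | no a-¬β with rival-active ka kb ra rb (trans (¬-not b-¬β) (sym (¬-not a-¬β)))
  ...   | d , kd , rd , d-rival = d , m<n⇒m<1+n kd , rd , (begin
    greedy (suc K) d    ≡⟨ greedy-old kd ⟩
    greedy K d          ≡⟨ d-rival ⟩
    not (greedy K b)    ≡⟨ cong not (¬-not b-¬β) ⟩
    not (not β)         ≡⟨ not-involutive β ⟩
    β                   ∎)
    where open ≡-Reasoning

  greedy-balancedBelow : ∀ K → BalancedBelow K (greedy K)
  greedy-balancedBelow zero τ β a≢b () kb ra rb
  greedy-balancedBelow (suc K) τ β a≢b ka kb ra rb
    with m<1+n⇒m<n∨m≡n ka | m<1+n⇒m<n∨m≡n kb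
  ... | inj₁ ka′ | inj₁ kb′ with greedy-balancedBelow K τ β a≢b ka′ kb′ ra rb
  ...   | d , kd , rd , cd = d , m<n⇒m<1+n kd , rd , trans (greedy-old kd) cd
  greedy-balancedBelow (suc K) τ β a≢b ka kb ra rb | inj₂ ka′ | inj₁ kb′ =
    newcomer-balanced K τ β ka′ kb′ ra rb
  greedy-balancedBelow (suc K) τ β a≢b ka kb ra rb | inj₁ ka′ | inj₂ kb′ =
    newcomer-balanced K τ β kb′ ka′ rb ra
  greedy-balancedBelow (suc K) τ β a≢b ka kb ra rb | inj₂ ka′ | inj₂ kb′ =
    ⊥-elim (a≢b (key-injective (trans ka′ (sym kb′))))

  balanced-colouring : ∃[ col ] Balanced col
  balanced-colouring = greedy K , balanced
    where
      K : ℕ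
      K = suc (maxᶠ n key)
      balanced : Balanced (greedy K)
      balanced τ β {a} {b} a≢b ra rb
        with greedy-balancedBelow K τ β a≢b (s≤s (≤-maxᶠ n key a)) (s≤s (≤-maxᶠ n key b)) ra rb
      ... | d , _ , rd , cd = d , rd , cd

2⊓[m+n]≤1⊓m+1⊓n : ∀ m n → (2 ≤ m → 1 ≤ n) → (2 ≤ n → 1 ≤ m) → 2 ⊓ (m + n) ≤ 1 ⊓ m + 1 ⊓ n
2⊓[m+n]≤1⊓m+1⊓n zero          zero          _   _   = z≤n
2⊓[m+n]≤1⊓m+1⊓n zero          (suc zero)    _   _   = ≤-refl
2⊓[m+n]≤1⊓m+1⊓n zero          (suc (suc n)) _   n⇒m with n⇒m (s≤s (s≤s z≤n))
... | ()
2⊓[m+n]≤1⊓m+1⊓n (suc zero)    zero          _   _   = ≤-refl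
2⊓[m+n]≤1⊓m+1⊓n (suc (suc m)) zero          m⇒n _   with m⇒n (s≤s (s≤s z≤n))
... | ()
2⊓[m+n]≤1⊓m+1⊓n (suc m)       (suc n)       _   _   = m⊓n≤m 2 _

-- a counts running J₂ jobs and m, n the running jobs of the two colour classes of J₁.
min2-bound : ∀ {r} a m n → r ≤ 2 * a + m + n → (2 ≤ m → 1 ≤ n) → (2 ≤ n → 1 ≤ m)
           → 2 ⊓ r ≤ 2 * a + (1 ∸ a) ⊓ m + (1 ∸ a) ⊓ n
min2-bound {r} zero    m n r≤ m⇒n n⇒m = ≤-trans (⊓-monoʳ-≤ 2 r≤) (2⊓[m+n]≤1⊓m+1⊓n m n m⇒n n⇒m)
min2-bound {r} (suc a) m n _  _   _   = begin
  2 ⊓ r                                               ≤⟨ m⊓n≤m 2 r ⟩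
  2 * 1                                               ≤⟨ *-monoʳ-≤ 2 (s≤s (z≤n {a})) ⟩
  2 * suc a                                           ≤⟨ ≤-trans (m≤m+n _ _) (m≤m+n _ _) ⟩
  2 * suc a + (1 ∸ suc a) ⊓ m + (1 ∸ suc a) ⊓ n       ∎
  where open ≤-Reasoning

consumption-split : ∀ {k} s → k ≡ 1 ⊎ k ≡ 2
                  → k ≤ 2 * ⟦ k ≡ᵇ 2 ⟧ + ⟦ (k ≡ᵇ 1) ∧ s ⟧ + ⟦ (k ≡ᵇ 1) ∧ not s ⟧
consumption-split true  (inj₁ refl) = ≤-refl
consumption-split false (inj₁ refl) = ≤-refl
consumption-split s     (inj₂ refl) = ≤-refl

module Schedule {n : ℕ} (p c x : Fin n → ℕ) where

  atTime : ℕ → (Fin n → ℕ) → Fin n → ℕ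
  atTime τ w i = if running (x i) (p i) τ then w i else 0

  load : (Fin n → ℕ) → ℕ → ℕ
  load w τ = Σᶠ n (atTime τ w)

  Σ<-load : ∀ w → Σ< (Cmax n p x) (load w) ≡ Σᶠ n (λ i → p i * w i)
  Σ<-load w = trans (Σ<-Σᶠ-comm (Cmax n p x) n λ i τ → atTime τ w i)
                    (Σᶠ-cong n λ i → Σ<-running (x i) (p i) (w i) (≤-Cmax n p x i))

  Σ<-load-⟦⟧ : ∀ b → Σ< (Cmax n p x) (load (⟦_⟧ ∘ b)) ≡ Σᶠ n (λ i → if b i then p i else 0)
  Σ<-load-⟦⟧ b = trans (Σ<-load (⟦_⟧ ∘ b)) (Σᶠ-cong n λ i → *-⟦⟧ (p i) (b i))

  load-⟦⟧ : ∀ b τ → load (⟦_⟧ ∘ b) τ ≡ count n (λ i → running (x i) (p i) τ ∧ b i)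
  load-⟦⟧ b τ = Σᶠ-cong n λ i → if-⟦⟧ (running (x i) (p i) τ) (b i)

  busy : ℕ → ℕ
  busy = load (λ i → ⟦ c i ≡ᵇ 2 ⟧)

  idle : ℕ → ℕ
  idle τ = 1 ∸ busy τ

  -- S colours J₁; class true is J′ and class false is J₁ ∖ J′.
  inClass : (Fin n → Bool) → Bool → Fin n → Bool
  inClass S β i = (c i ≡ᵇ 1) ∧ matches β (S i)

  classLoad : (Fin n → Bool) → Bool → ℕ → ℕ
  classLoad S β = load (⟦_⟧ ∘ inClass S β)

  classTime : (Fin n → Bool) → Bool → ℕ
  classTime S β = Σᶠ n (λ i → if inClass S β i then p i else 0)

  NoJ₂Overlap : Set
  NoJ₂Overlap = ∀ i j → i ≢ j → c i ≡ 2 → c j ≡ 2 → ¬ Overlap (x i) (p i) (x j) (p j)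

  busy≤1 : NoJ₂Overlap → ∀ τ → busy τ ≤ 1
  busy≤1 disjoint τ = ≮⇒≥ two-busy⇒⊥
    where
      two-busy⇒⊥ : ¬ (2 ≤ busy τ)
      two-busy⇒⊥ h with count-≥2⇒ n _ (subst (2 ≤_) (load-⟦⟧ _ τ) h)
      ... | a , b , a≢b , ta , tb with running-∧⇒ _ _ τ _ ta | running-∧⇒ _ _ τ _ tb
      ...   | ra , ca | rb , cb = disjoint a b a≢b (≡ᵇ⇒≡ _ _ ca) (≡ᵇ⇒≡ _ _ cb) (τ , ra , rb)

  Σ<-idle≤ : NoJ₂Overlap → ∀ {M} → Cmax n p x ≤ M → Σ< (Cmax n p x) idle ≤ M ∸ pJ2 n p c
  Σ<-idle≤ disjoint {M} feasible = m+n≤o⇒m≤o∸n _ (begin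
    Σ< Tm idle + pJ2 n p c      ≡⟨ cong (Σ< Tm idle +_) (Σ<-load-⟦⟧ (λ i → c i ≡ᵇ 2)) ⟨
    Σ< Tm idle + Σ< Tm busy     ≡⟨ Σ<-complement Tm busy (busy≤1 disjoint) ⟩
    Tm                          ≤⟨ feasible ⟩
    M                           ∎)
    where
      open ≤-Reasoning
      Tm : ℕ
      Tm = Cmax n p x

  load≤ : (∀ i → c i ≡ 1 ⊎ c i ≡ 2) → ∀ S τ
        → load c τ ≤ 2 * busy τ + classLoad S true τ + classLoad S false τ
  load≤ c∈ S τ = begin
    load c τ                      ≤⟨ Σᶠ-mono n job ⟩
    Σᶠ n (λ i → 2 * on₂ i + on₁ true i + on₁ false i)
      ≡⟨ 2*+-linear (Σᶠ n) (Σᶠ-+ n) (Σᶠ-* n 2) on₂ (on₁ true) (on₁ false) ⟩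
    2 * busy τ + classLoad S true τ + classLoad S false τ ∎
    where
      open ≤-Reasoning
      on₂ : Fin n → ℕ
      on₂ = atTime τ (λ i → ⟦ c i ≡ᵇ 2 ⟧)
      on₁ : Bool → Fin n → ℕ
      on₁ β = atTime τ (⟦_⟧ ∘ inClass S β)
      job : ∀ i → atTime τ c i ≤ 2 * on₂ i + on₁ true i + on₁ false i
      job i with running (x i) (p i) τ
      ... | true  = consumption-split (S i) (c∈ i)
      ... | false = z≤n

  -- J₂ jobs get length 0, so that only J₁ jobs take part in the colouring.
  J₁lengths : Fin n → ℕ
  J₁lengths i = if c i ≡ᵇ 1 then p i else 0

  open IntervalColouring x J₁lengths using (Balanced; balanced-colouring)

  J₁-active : ∀ {i τ} b → T (running (x i) (p i) τ ∧ ((c i ≡ᵇ 1) ∧ b)) → Runs (x i) (J₁lengths i) τ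
  J₁-active {i} {τ} b h with running-∧⇒ (x i) (p i) τ _ h
  ... | r , t = subst (λ l → Runs (x i) l τ) (sym (if-T {b = c i ≡ᵇ 1} j₁)) r
    where
      j₁ : T (c i ≡ᵇ 1)
      j₁ = proj₁ (Equivalence.to (T-∧ {c i ≡ᵇ 1} {b}) t)

  active-J₁ : ∀ {i τ} b → Runs (x i) (J₁lengths i) τ → T b
            → T (running (x i) (p i) τ ∧ ((c i ≡ᵇ 1) ∧ b))
  active-J₁ {i} b r t with Runs-if⇒ (c i ≡ᵇ 1) r
  ... | j₁ , r′ = Equivalence.from T-∧ (Runs⇒running r′ , Equivalence.from T-∧ (j₁ , t))

  classLoad-spread : ∀ {S} → Balanced S → ∀ β τ → 2 ≤ classLoad S β τ → 1 ≤ classLoad S (not β) τ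
  classLoad-spread {S} balanced β τ h
    with count-≥2⇒ n _ (subst (2 ≤_) (load-⟦⟧ (inClass S β) τ) h)
  ... | a , b , a≢b , ta , tb
    with balanced τ (not β) a≢b (J₁-active (matches β (S a)) ta) (J₁-active (matches β (S b)) tb)
  ...   | d , rd , cd =
    subst (1 ≤_) (sym (load-⟦⟧ (inClass S (not β)) τ))
          (count-pos n _ d (active-J₁ (matches (not β) (S d)) rd (≡⇒matches cd)))

  min2-load≤ : (∀ i → c i ≡ 1 ⊎ c i ≡ 2) → ∀ {S} → Balanced S → ∀ τ
             → 2 ⊓ load c τ ≤ 2 * busy τ + idle τ ⊓ classLoad S true τ
                                             + idle τ ⊓ classLoad S false τ
  min2-load≤ c∈ {S} balanced τ =
    min2-bound (busy τ) _ _ (load≤ c∈ S τ)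
               (classLoad-spread balanced true τ) (classLoad-spread balanced false τ)

  F-bound : (∀ i → c i ≡ 1 ⊎ c i ≡ 2) → NoJ₂Overlap → ∀ {M} → Cmax n p x ≤ M → ∀ {S} → Balanced S
          → F n p c x ≤ 2 * pJ2 n p c + classTime S true ⊓ (M ∸ pJ2 n p c)
                                      + classTime S false ⊓ (M ∸ pJ2 n p c)
  F-bound c∈ disjoint {M} feasible {S} balanced = begin
    F n p c x
      ≤⟨ Σ<-mono Tm (min2-load≤ c∈ balanced) ⟩
    Σ< Tm (λ τ → 2 * busy τ + share true τ + share false τ)
      ≡⟨ 2*+-linear (Σ< Tm) (Σ<-+ Tm) (Σ<-* Tm 2) busy (share true) (share false) ⟩
    2 * Σ< Tm busy + Σ< Tm (share true) + Σ< Tm (share false)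
      ≤⟨ +-mono-≤ (+-mono-≤ (≤-reflexive (cong (2 *_) (Σ<-load-⟦⟧ (λ i → c i ≡ᵇ 2))))
                            (Σ<-share true)) (Σ<-share false) ⟩
    2 * pJ2 n p c + classTime S true ⊓ (M ∸ pJ2 n p c) + classTime S false ⊓ (M ∸ pJ2 n p c) ∎
    where
      open ≤-Reasoning
      Tm : ℕ
      Tm = Cmax n p x
      share : Bool → ℕ → ℕ
      share β τ = idle τ ⊓ classLoad S β τ
      Σ<-share : ∀ β → Σ< Tm (share β) ≤ classTime S β ⊓ (M ∸ pJ2 n p c)
      Σ<-share β = begin
        Σ< Tm (share β)                          ≤⟨ Σ<-⊓ Tm idle (classLoad S β) ⟩
        Σ< Tm idle ⊓ Σ< Tm (classLoad S β)       ≡⟨ ⊓-comm _ _ ⟩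
        Σ< Tm (classLoad S β) ⊓ Σ< Tm idle
          ≤⟨ ⊓-mono-≤ (≤-reflexive (Σ<-load-⟦⟧ (inClass S β))) (Σ<-idle≤ disjoint feasible) ⟩
        classTime S β ⊓ (M ∸ pJ2 n p c)          ∎

lemma9 : (n : ℕ) (p c : Fin n → ℕ) (M : ℕ)
         → (∀ i → c i ≡ 1 ⊎ c i ≡ 2)
         → pJ2 n p c < M
         → (x : Fin n → ℕ)
         → Feasible n p x M
         → (∀ i j → i ≢ j → c i ≡ 2 → c j ≡ 2 → ¬ Overlap (x i) (p i) (x j) (p j))
         → ∃[ S ] (F n p c x ≤ 2 * pJ2 n p c
                                 + (pJ' n p c S ⊓ (M ∸ pJ2 n p c))
                                 + (pJ1∖J' n p c S ⊓ (M ∸ pJ2 n p c)))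
lemma9 n p c M c∈ _ x feasible disjoint =
  let S , balanced = IntervalColouring.balanced-colouring x (Schedule.J₁lengths p c x)
  in  S , Schedule.F-bound p c x c∈ disjoint feasible balanced
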